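{- Let $\mathbf{a}$ and $\mathbf{b}$ be two unroll trees admitting periodic patterns of sizes $a$ and $b$ respectively, and let $n\ge 2\max(a,b)+\max(\mathrm{depth}(\mathbf{a}),\mathrm{depth}(\mathbf{b}))$. Then $\mathbf{a}\ne\mathbf{b}$ if and only if $[\mathbf{a}]_n\ne[\mathbf{b}]_n$.
   Context: A finite discrete-time dynamical system (FDDS) is a pair $(S,f)$ with $S$ finite and $f:S\to S$. A state is periodic if it lies on a cycle; the depth of an FDDS is the maximum over states $s$ of the least $t\ge0$ with $f^t(s)$ periodic. For a periodic state $u$, the unroll tree in $u$ is the infinite rooted tree with vertex set $\{(s,k)\mid k\in\mathbb{N},\ f^k(s)=u\}$, root $(u,0)$ and arcs $(v,k)\to(f(v),k-1)$. An unroll tree is any tree arising this way; its depth is the depth of a connected FDDS having it among its unroll trees. An unroll tree has exactly one infinite branch $w_0,w_1,w_2,\ldots$ ($w_0$ the root, $w_{i+1}$ a predecessor of $w_i$); let $\mathbf{t}_i$ be the finite tree consisting of $w_i$ and its descendants not in the subtree of $w_{i+1}$. A periodic pattern of size $p\ge1$ is a sequence $(\mathbf{t}_0,\ldots,\mathbf{t}_{p-1})$ such that $\mathbf{t}_i\cong\mathbf{t}_{i\bmod p}$ for all $i\in\mathbb{N}$. The depth of a node is its distance to the root; $[\mathbf{t}]_n$ is the induced subtree on vertices of depth at most $n$. Equality means isomorphism of rooted trees. -}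

module Defs where

open import Data.Nat using (ℕ; zero; suc; _≤_; _<_; _∸_; _%_)
open import Data.Fin using (Fin)
open import Data.Product using (Σ; ∃; ∃-syntax; _×_; _,_)
open import Relation.Binary.PropositionalEquality using (_≡_)
open import Relation.Nullary using (¬_)

record FDDS : Set where
  field
    size : ℕ
    f    : Fin size → Fin size

iter : ∀ {m} → (Fin m → Fin m) → ℕ → Fin m → Fin m
iter f zero    s = s
iter f (suc k) s = iter f k (f s)

Periodic : ∀ {m} → (Fin m → Fin m) → Fin m → Set
Periodic f s = ∃[ k ] (iter f (suc k) s ≡ s)

-- A rooted tree presented as a subset (mem) of a base type B, with a root
-- and an arc relation (Arc x y : arc x → y, i.e. y is the parent of x).
record RTree : Set₁ where
  field
    B    : Set
    mem  : B → Set
    root : B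
    Arc  : B → B → Set

open RTree

record _≅_ (T U : RTree) : Set where
  field
    to       : B T → B U
    from     : B U → B T
    to-mem   : ∀ {x} → mem T x → mem U (to x)
    from-mem : ∀ {y} → mem U y → mem T (from y)
    from-to  : ∀ {x} → mem T x → from (to x) ≡ x
    to-from  : ∀ {y} → mem U y → to (from y) ≡ y
    to-root  : to (root T) ≡ root U
    to-arc   : ∀ {x y} → mem T x → mem T y → Arc T x y → Arc U (to x) (to y)
    from-arc : ∀ {x y} → mem U x → mem U y → Arc U x y → Arc T (from x) (from y)

record Unroll : Set where
  field
    sys : FDDS
    u   : Fin (FDDS.size sys)
    per : Periodic (FDDS.f sys) u

module _ (A : Unroll) where
  open Unroll A
  open FDDS sys

  unrollArc : Fin size × ℕ → Fin size × ℕ → Set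
  unrollArc (s , k) (s' , k') = (f s ≡ s') × (k ≡ suc k')

  unrollTree : RTree
  unrollTree = record
    { B    = Fin size × ℕ
    ; mem  = λ { (s , k) → iter f k s ≡ u }
    ; root = (u , 0)
    ; Arc  = unrollArc }

  -- [a]_n : induced subtree on vertices of depth ≤ n (depth of (s,k) is k)
  trunc : ℕ → RTree
  trunc n = record
    { B    = Fin size × ℕ
    ; mem  = λ { (s , k) → (iter f k s ≡ u) × (k ≤ n) }
    ; root = (u , 0)
    ; Arc  = unrollArc }

  -- an infinite branch w_0 = (w 0, 0), w_1 = (w 1, 1), ... starting at the root
  IsBranch : (ℕ → Fin size) → Set
  IsBranch w = (w 0 ≡ u) × (∀ i → f (w (suc i)) ≡ w i)

  -- t_i : w_i and its descendants not in the subtree of w_{i+1}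
  piece : (ℕ → Fin size) → ℕ → RTree
  piece w i = record
    { B    = Fin size × ℕ
    ; mem  = λ { (s , k) → (i ≤ k) × (iter f (k ∸ i) s ≡ w i)
                   × ¬ ((suc i ≤ k) × (iter f (k ∸ suc i) s ≡ w (suc i))) }
    ; root = (w i , i)
    ; Arc  = unrollArc }

  HasPattern : ℕ → Set
  HasPattern p = ∃[ q ] ((p ≡ suc q) × ∃[ w ] (IsBranch w
                   × (∀ i → piece w i ≅ piece w (i % suc q))))

  InComp : Fin size → Set
  InComp s = ∃[ k ] (iter f k s ≡ u)

  -- d is the depth of the connected component of u:
  -- the maximum over its states s of the least t with f^t(s) periodic
  IsDepth : ℕ → Set
  IsDepth d = (∀ s → InComp s → ∃[ t ] ((t ≤ d) × Periodic f (iter f t s)))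
            × (∃[ s ] (InComp s × Periodic f (iter f d s)
                 × (∀ t → t < d → ¬ Periodic f (iter f t s))))

-- Isomorphisms of unroll trees preserve depths, so they restrict to the truncations. Conversely,
-- cut both trees along their infinite branches w and v into the finite pieces t_j. With d the larger depth, a
-- vertex of t_j has depth at most j + d, since deeper vertices have a periodic ancestor at depth j + 1,
-- which can only be w (j + 1). An isomorphism of the n-truncations sends w j to v j whenever
-- j + d ≤ n, because the image of w n has a periodic ancestor at depth j; hence it restricts to
-- isomorphisms t_j ≅ t′_j for all j < a + b. Periodicity propagates these to every j, through
--   t_(k+a+b) ≅ t_(k+b) ≅ t′_(k+b) ≅ t′_k ≅ t_k ≅ t_(k+a) ≅ t′_(k+a) ≅ t′_(k+a+b),
-- and the piecewise isomorphisms glue to an isomorphism of the unroll trees.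

module Submission where

open import Defs
open import Data.Empty using (⊥-elim)
open import Data.Fin using (Fin) renaming (_≟_ to _≟ᶠ_)
open import Data.Nat
  using (ℕ; zero; suc; _≤_; _<_; _+_; _*_; _⊔_; _∸_; _%_; z≤n; _≤?_; _<?_; NonZero; >-nonZero⁻¹)
open import Data.Nat.DivMod using ([m+n]%n≡m%n)
open import Data.Nat.Induction using (<-rec)
open import Data.Nat.Properties
open import Data.Sum using (inj₁; inj₂)
open import Data.Product using (∃-syntax; _×_; _,_; proj₁; proj₂)
open import Relation.Binary.PropositionalEquality
open import Relation.Nullary using (¬_; Dec; yes; no)
open import Relation.Nullary.Decidable using (_×-dec_)
open import Relation.Unary using (Decidable)

open RTree

m+n≤o⇒n≤o∸m : ∀ m {n o} → m + n ≤ o → n ≤ o ∸ m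
m+n≤o⇒n≤o∸m m {n} {o} le = m+n≤o⇒m≤o∸n n (subst (_≤ o) (+-comm m n) le)

module _ {p} {P : ℕ → Set p} (P? : Decidable P) where

  -- the greatest j ≤ c satisfying P, and 0 if there is none
  greatest : ℕ → ℕ
  greatest zero = zero
  greatest (suc c) with P? (suc c)
  ... | yes _ = suc c
  ... | no  _ = greatest c

  greatest-satisfies : P 0 → ∀ c → P (greatest c)
  greatest-satisfies p₀ zero = p₀
  greatest-satisfies p₀ (suc c) with P? (suc c)
  ... | yes p = p
  ... | no  _ = greatest-satisfies p₀ c

  greatest-maximal : ∀ c {j} → greatest c < j → j ≤ c → ¬ P j
  greatest-maximal zero lt j≤0 = ⊥-elim (n≮n 0 (<-≤-trans lt j≤0))
  greatest-maximal (suc c) {j} lt j≤1+c with P? (suc c)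
  ... | yes _ = ⊥-elim (n≮n (suc c) (<-≤-trans lt j≤1+c))
  ... | no ¬p with m≤n⇒m<n∨m≡n j≤1+c
  ...   | inj₁ j<1+c = greatest-maximal c lt (≤-pred j<1+c)
  ...   | inj₂ refl  = ¬p

module _ {m} (f : Fin m → Fin m) where

  iter-+ : ∀ a b s → iter f (a + b) s ≡ iter f b (iter f a s)
  iter-+ zero    b s = refl
  iter-+ (suc a) b s = iter-+ a b (f s)

  iter-∸ : ∀ {j k} s → j ≤ k → iter f j (iter f (k ∸ j) s) ≡ iter f k s
  iter-∸ {j} {k} s j≤k =
    trans (sym (iter-+ (k ∸ j) j s)) (cong (λ t → iter f t s) (m∸n+n≡m j≤k))

  iter-f : ∀ k s → iter f k (f s) ≡ f (iter f k s)
  iter-f zero    s = refl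
  iter-f (suc k) s = iter-f k (f s)

  iter-* : ∀ c k {s} → iter f k s ≡ s → iter f (c * k) s ≡ s
  iter-* zero    k e = refl
  iter-* (suc c) k {s} e = begin
    iter f (k + c * k) s          ≡⟨ iter-+ k (c * k) s ⟩
    iter f (c * k) (iter f k s)   ≡⟨ cong (iter f (c * k)) e ⟩
    iter f (c * k) s              ≡⟨ iter-* c k e ⟩
    s                             ∎
    where open ≡-Reasoning

  Periodic-f : ∀ {s} → Periodic f s → Periodic f (f s)
  Periodic-f {s} (k , e) = k , trans (iter-f (suc k) s) (cong f e)

  Periodic-iter : ∀ t {s} → Periodic f s → Periodic f (iter f t s)
  Periodic-iter zero    p = p
  Periodic-iter (suc t) p = Periodic-iter t (Periodic-f p)

  Periodic-later : ∀ {t t′ s} → t ≤ t′ → Periodic f (iter f t s) → Periodic f (iter f t′ s)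
  Periodic-later {t} {t′} {s} t≤t′ p = subst (Periodic f) eq (Periodic-iter (t′ ∸ t) p)
    where
      eq : iter f (t′ ∸ t) (iter f t s) ≡ iter f t′ s
      eq = trans (sym (iter-+ t (t′ ∸ t) s)) (cong (λ t″ → iter f t″ s) (m+[n∸m]≡n t≤t′))

  -- Going (q + 1) times around the cycle of x and (p + 1) times around that of y undoes f on both.
  periodic-f-injective : ∀ {x y} → Periodic f x → Periodic f y → f x ≡ f y → x ≡ y
  periodic-f-injective {x} {y} (p , x-cycle) (q , y-cycle) e = begin
    x                           ≡⟨ sym (iter-* (suc q) (suc p) x-cycle) ⟩
    iter f N (f x)              ≡⟨ cong (iter f N) e ⟩
    iter f (suc q * suc p) y    ≡⟨ cong (λ t → iter f t y) (*-comm (suc q) (suc p)) ⟩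
    iter f (suc p * suc q) y    ≡⟨ iter-* (suc p) (suc q) y-cycle ⟩
    y                           ∎
    where
      open ≡-Reasoning
      N = p + q * suc p

  periodic-iter-injective : ∀ j {x y} → Periodic f x → Periodic f y →
                            iter f j x ≡ iter f j y → x ≡ y
  periodic-iter-injective zero    px py e = e
  periodic-iter-injective (suc j) px py e =
    periodic-f-injective px py (periodic-iter-injective j (Periodic-f px) (Periodic-f py) e)

≅-sym : ∀ {T U} → mem T (root T) → T ≅ U → U ≅ T
≅-sym r φ = record
  { to = from ; from = to ; to-mem = from-mem ; from-mem = to-mem
  ; from-to = to-from ; to-from = from-to
  ; to-root = trans (cong from (sym to-root)) (from-to r)
  ; to-arc = from-arc ; from-arc = to-arc }
  where open _≅_ φ

≅-trans : ∀ {T U V} → T ≅ U → U ≅ V → T ≅ V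
≅-trans φ ψ = record
  { to = λ x → Ψ.to (Φ.to x) ; from = λ y → Φ.from (Ψ.from y)
  ; to-mem = λ x∈ → Ψ.to-mem (Φ.to-mem x∈)
  ; from-mem = λ y∈ → Φ.from-mem (Ψ.from-mem y∈)
  ; from-to = λ x∈ → trans (cong Φ.from (Ψ.from-to (Φ.to-mem x∈))) (Φ.from-to x∈)
  ; to-from = λ y∈ → trans (cong Ψ.to (Φ.to-from (Ψ.from-mem y∈))) (Ψ.to-from y∈)
  ; to-root = trans (cong Ψ.to Φ.to-root) Ψ.to-root
  ; to-arc = λ x∈ y∈ a → Ψ.to-arc (Φ.to-mem x∈) (Φ.to-mem y∈) (Φ.to-arc x∈ y∈ a)
  ; from-arc = λ x∈ y∈ a → Φ.from-arc (Ψ.from-mem x∈) (Ψ.from-mem y∈) (Ψ.from-arc x∈ y∈ a) }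
  where
    module Φ = _≅_ φ
    module Ψ = _≅_ ψ

infixr 5 _⨾_
_⨾_ : ∀ {T U V} → T ≅ U → U ≅ V → T ≅ V
_⨾_ = ≅-trans

State : Unroll → Set
State A = Fin (FDDS.size (Unroll.sys A))

step : (A : Unroll) → State A → State A
step A = FDDS.f (Unroll.sys A)

Vertex : Unroll → Set
Vertex A = State A × ℕ

-- unrollTree A and trunc A n are, definitionally, subtree A applied to their membership predicates
subtree : (A : Unroll) → (Vertex A → Set) → RTree
subtree A P = record { B = Vertex A ; mem = P ; root = (Unroll.u A , 0) ; Arc = unrollArc A }

trunc-parent : ∀ A n {s k} → mem (trunc A n) (s , suc k) → mem (trunc A n) (step A s , k)
trunc-parent A n (on-tree , 1+k≤n) = on-tree , ≤-trans (n≤1+n _) 1+k≤n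

module SubtreeIso (A C : Unroll) {P : Vertex A → Set} {Q : Vertex C → Set}
  (P⊆tree : ∀ {x} → P x → mem (unrollTree A) x)
  (P-parent : ∀ {s k} → P (s , suc k) → P (step A s , k))
  (φ : subtree A P ≅ subtree C Q) where
  open _≅_ φ

  to-depth : ∀ {s k} → P (s , k) → proj₂ (to (s , k)) ≡ k
  to-depth {k = zero} x∈ with P⊆tree x∈
  ... | refl = cong proj₂ to-root
  to-depth {k = suc k} x∈ =
    trans (proj₂ (to-arc x∈ (P-parent x∈) (refl , refl))) (cong suc (to-depth (P-parent x∈)))

  to-iter : ∀ t {s k K} → t + k ≡ K → P (s , K) →
            proj₁ (to (iter (step A) t s , k)) ≡ iter (step C) t (proj₁ (to (s , K)))
  to-iter zero    refl x∈ = refl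
  to-iter (suc t) refl x∈ = trans (to-iter t refl (P-parent x∈))
    (cong (iter (step C) t) (sym (proj₁ (to-arc x∈ (P-parent x∈) (refl , refl)))))

trunc-≅ : ∀ A C n → unrollTree A ≅ unrollTree C → trunc A n ≅ trunc C n
trunc-≅ A C n φ = record
  { to = to ; from = from
  ; to-mem = λ (x∈ , k≤n) → to-mem x∈ , subst (_≤ n) (sym (Forth.to-depth x∈)) k≤n
  ; from-mem = λ (y∈ , k≤n) → from-mem y∈ , subst (_≤ n) (sym (Back.to-depth y∈)) k≤n
  ; from-to = λ x∈ → from-to (proj₁ x∈) ; to-from = λ y∈ → to-from (proj₁ y∈)
  ; to-root = to-root
  ; to-arc = λ x∈ y∈ → to-arc (proj₁ x∈) (proj₁ y∈)
  ; from-arc = λ x∈ y∈ → from-arc (proj₁ x∈) (proj₁ y∈) }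
  where
    open _≅_ φ
    module Forth = SubtreeIso A C (λ x∈ → x∈) (λ x∈ → x∈) φ
    module Back  = SubtreeIso C A (λ y∈ → y∈) (λ y∈ → y∈) (≅-sym refl φ)

DepthAtMost : Unroll → ℕ → Set
DepthAtMost A d = ∀ s → InComp A s → ∃[ t ] ((t ≤ d) × Periodic (step A) (iter (step A) t s))

IsDepth⇒DepthAtMost : ∀ A {da d} → IsDepth A da → da ≤ d → DepthAtMost A d
IsDepth⇒DepthAtMost A (bound , _) da≤d s s∈ with bound s s∈
... | t , t≤da , p = t , ≤-trans t≤da da≤d , p

depth-periodic : ∀ A {d t s} → DepthAtMost A d → d ≤ t → InComp A s →
                 Periodic (step A) (iter (step A) t s)
depth-periodic A D d≤t s∈ with D _ s∈
... | t₀ , t₀≤d , p = Periodic-later (step A) (≤-trans t₀≤d d≤t) p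

module Branch (A : Unroll) {w : ℕ → State A} (bw : IsBranch A w) where
  private
    f = step A
    u = Unroll.u A

  iter-branch : ∀ t j → iter f t (w (t + j)) ≡ w j
  iter-branch zero    j = refl
  iter-branch (suc t) j = trans (cong (iter f t) (proj₂ bw (t + j))) (iter-branch t j)

  iter-branch-∸ : ∀ {j k} → j ≤ k → iter f (k ∸ j) (w k) ≡ w j
  iter-branch-∸ {j} {k} j≤k =
    subst (λ K → iter f (k ∸ j) (w K) ≡ w j) (m∸n+n≡m j≤k) (iter-branch (k ∸ j) j)

  branch∈tree : ∀ j → iter f j (w j) ≡ u
  branch∈tree j = trans (iter-branch-∸ {k = j} z≤n) (proj₁ bw)

  Below : ℕ → Vertex A → Set
  Below j (s , k) = (j ≤ k) × (iter f (k ∸ j) s ≡ w j)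

  Below? : ∀ j x → Dec (Below j x)
  Below? j (s , k) = (j ≤? k) ×-dec (iter f (k ∸ j) s ≟ᶠ w j)

  below⊆tree : ∀ {j s k} → Below j (s , k) → iter f k s ≡ u
  below⊆tree {j} {s} (j≤k , e) =
    trans (sym (iter-∸ f s j≤k)) (trans (cong (iter f j) e) (branch∈tree j))

  below-mono : ∀ {i j s k} → i ≤ j → Below j (s , k) → Below i (s , k)
  below-mono {i} {j} {s} {k} i≤j (j≤k , e) = ≤-trans i≤j j≤k , (begin
    iter f (k ∸ i) s                      ≡⟨ cong (λ t → iter f t s) split ⟩
    iter f ((k ∸ j) + (j ∸ i)) s          ≡⟨ iter-+ f (k ∸ j) (j ∸ i) s ⟩
    iter f (j ∸ i) (iter f (k ∸ j) s)     ≡⟨ cong (iter f (j ∸ i)) e ⟩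
    iter f (j ∸ i) (w j)                  ≡⟨ iter-branch-∸ i≤j ⟩
    w i                                   ∎)
    where
      open ≡-Reasoning
      split : k ∸ i ≡ (k ∸ j) + (j ∸ i)
      split = trans (cong (_∸ i) (sym (m∸n+n≡m j≤k))) (+-∸-assoc (k ∸ j) i≤j)

  below-same-depth : ∀ {s k} → Below k (s , k) → s ≡ w k
  below-same-depth {s} {k} (_ , e) = trans (cong (λ t → iter f t s) (sym (n∸n≡0 k))) e

  below-parent : ∀ {j s k} → j ≤ k → Below j (s , suc k) → Below j (f s , k)
  below-parent {j} {s} {k} j≤k (_ , e) =
    j≤k , trans (cong (λ t → iter f t s) (sym (+-∸-assoc 1 j≤k))) e

  below-child : ∀ {j s k} → Below j (f s , k) → Below j (s , suc k)
  below-child {j} {s} {k} (j≤k , e) =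
    m≤n⇒m≤1+n j≤k , trans (cong (λ t → iter f t s) (+-∸-assoc 1 j≤k)) e

  piece⊆below : ∀ {j s k} → mem (piece A w j) (s , k) → Below j (s , k)
  piece⊆below (j≤k , e , _) = j≤k , e

  piece⊆tree : ∀ {j s k} → mem (piece A w j) (s , k) → iter f k s ≡ u
  piece⊆tree pm = below⊆tree (piece⊆below pm)

  root∈piece : ∀ i → mem (piece A w i) (w i , i)
  root∈piece i = ≤-refl , iter-branch-∸ ≤-refl , λ (1+i≤i , _) → n≮n i 1+i≤i

  piece-parent : ∀ {i s k} → mem (piece A w i) (s , suc k) → i ≤ k → mem (piece A w i) (f s , k)
  piece-parent (i≤1+k , e , ¬below) i≤k =
    proj₁ b , proj₂ b , λ below → ¬below (below-child below)
    where b = below-parent i≤k (i≤1+k , e)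

  piece-below : ∀ {i j s k} → mem (piece A w i) (s , k) → i < j → ¬ Below j (s , k)
  piece-below (_ , _ , ¬below) i<j below = ¬below (below-mono i<j below)

  pieces-disjoint : ∀ {i j s k} → mem (piece A w i) (s , k) → mem (piece A w j) (s , k) → i ≡ j
  pieces-disjoint pi pj = ≤-antisym
    (≮⇒≥ λ j<i → piece-below pj j<i (piece⊆below pi))
    (≮⇒≥ λ i<j → piece-below pi i<j (piece⊆below pj))

  index : Vertex A → ℕ
  index (s , k) = greatest (λ j → Below? j (s , k)) k

  index-piece : ∀ {s k} → iter f k s ≡ u → mem (piece A w (index (s , k))) (s , k)
  index-piece {s} {k} on-tree = proj₁ below , proj₂ below ,
    λ below′ → greatest-maximal P? k ≤-refl (proj₁ below′) below′
    where
      P? = λ j → Below? j (s , k)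
      below : Below (index (s , k)) (s , k)
      below = greatest-satisfies P? (z≤n , trans on-tree (sym (proj₁ bw))) k

  index-unique : ∀ {i s k} → mem (piece A w i) (s , k) → index (s , k) ≡ i
  index-unique pm = pieces-disjoint (index-piece (piece⊆tree pm)) pm

  module _ {d} (D : DepthAtMost A d) where

    branch-periodic : ∀ i → Periodic f (w i)
    branch-periodic i =
      subst (Periodic f) (iter-branch d i) (depth-periodic A D ≤-refl (d + i , branch∈tree (d + i)))

    periodic-on-branch : ∀ j {s} → Periodic f s → iter f j s ≡ u → s ≡ w j
    periodic-on-branch j ps e =
      periodic-iter-injective f j ps (branch-periodic j) (trans e (sym (branch∈tree j)))

    -- below depth j + d, the ancestor at depth j + 1 is periodic, hence it is w (j + 1)
    piece-height : ∀ {j s k} → mem (piece A w j) (s , k) → k ≤ j + d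
    piece-height {j} {s} {k} pm@(_ , _ , ¬below) =
      ≮⇒≥ λ j+d<k → ¬below (1+j≤k j+d<k , ancestor-on-branch j+d<k)
      where
        on-tree = piece⊆tree pm
        1+j≤k : j + d < k → suc j ≤ k
        1+j≤k j+d<k = ≤-trans (m≤m+n (suc j) d) j+d<k
        ancestor-on-branch : j + d < k → iter f (k ∸ suc j) s ≡ w (suc j)
        ancestor-on-branch j+d<k = periodic-on-branch (suc j)
          (depth-periodic A D (m+n≤o⇒n≤o∸m (suc j) j+d<k) (k , on-tree))
          (trans (iter-∸ f s (1+j≤k j+d<k)) on-tree)

module Glue (A C : Unroll) {w v} (bw : IsBranch A w) (bv : IsBranch C v)
  (ψ : ∀ i → piece A w i ≅ piece C v i) where
  private
    module BA = Branch A bw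
    module BC = Branch C bv
    module ψ i = _≅_ (ψ i)

  glued : Vertex A → Vertex C
  glued x = ψ.to (BA.index x) x

  glued-on-piece : ∀ {i s k} → mem (piece A w i) (s , k) → glued (s , k) ≡ ψ.to i (s , k)
  glued-on-piece {s = s} {k} pm = cong (λ j → ψ.to j (s , k)) (BA.index-unique pm)

  glued-mem : ∀ {s k} → mem (unrollTree A) (s , k) → mem (unrollTree C) (glued (s , k))
  glued-mem x∈ = BC.piece⊆tree (ψ.to-mem _ (BA.index-piece x∈))

  glued-inverse : ∀ {s k} → mem (unrollTree A) (s , k) →
                  ψ.from (BC.index (glued (s , k))) (glued (s , k)) ≡ (s , k)
  glued-inverse x∈ =
    trans (cong (λ j → ψ.from j (glued _)) (BC.index-unique y∈)) (ψ.from-to _ x∈′)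
    where
      x∈′ = BA.index-piece x∈
      y∈ = ψ.to-mem _ x∈′

  glued-branch : ∀ j → glued (w j , j) ≡ (v j , j)
  glued-branch j = trans (glued-on-piece (BA.root∈piece j)) (ψ.to-root j)

  glued-root : glued (Unroll.u A , 0) ≡ (Unroll.u C , 0)
  glued-root =
    subst₂ (λ s s′ → glued (s , 0) ≡ (s′ , 0)) (proj₁ bw) (proj₁ bv) (glued-branch 0)

  glued-branch-arc : ∀ k → unrollArc C (glued (w (suc k) , suc k)) (glued (step A (w (suc k)) , k))
  glued-branch-arc k = subst₂ (unrollArc C) (sym (glued-branch (suc k)))
    (sym (trans (cong (λ s → glued (s , k)) (proj₂ bw k)) (glued-branch k)))
    (proj₂ bv k , refl)

  -- an arc either stays inside one piece or joins the roots of consecutive pieces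
  glued-arc : ∀ {x y} → mem (unrollTree A) x → mem (unrollTree A) y →
              unrollArc A x y → unrollArc C (glued x) (glued y)
  glued-arc {s , suc k} x∈ _ (refl , refl) with BA.index (s , suc k) ≤? k
  ... | yes i≤k =
    subst₂ (unrollArc C) (sym (glued-on-piece pm)) (sym (glued-on-piece pm′))
      (ψ.to-arc _ pm pm′ (refl , refl))
    where
      pm = BA.index-piece x∈
      pm′ = BA.piece-parent pm i≤k
  ... | no i≰k =
    subst (λ s → unrollArc C (glued (s , suc k)) (glued (step A s , k))) (sym s≡w) (glued-branch-arc k)
    where
      pm = BA.index-piece x∈
      i≡1+k : BA.index (s , suc k) ≡ suc k
      i≡1+k = ≤-antisym (proj₁ pm) (≰⇒> i≰k)
      s≡w : s ≡ w (suc k)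
      s≡w = BA.below-same-depth (subst (λ i → BA.Below i (s , suc k)) i≡1+k (BA.piece⊆below pm))

glue : ∀ A C {w v} (bw : IsBranch A w) (bv : IsBranch C v) →
       (∀ i → piece A w i ≅ piece C v i) → unrollTree A ≅ unrollTree C
glue A C bw bv ψ = record
  { to = Forth.glued ; from = Back.glued
  ; to-mem = Forth.glued-mem ; from-mem = Back.glued-mem
  ; from-to = Forth.glued-inverse ; to-from = Back.glued-inverse
  ; to-root = Forth.glued-root
  ; to-arc = Forth.glued-arc ; from-arc = Back.glued-arc }
  where
    module Forth = Glue A C bw bv ψ
    module Back  = Glue C A bv bw (λ i → ≅-sym (Branch.root∈piece A bw i) (ψ i))

module Restrict (A C : Unroll) {w v} (bw : IsBranch A w) (bv : IsBranch C v)
  {d} (DA : DepthAtMost A d) (DC : DepthAtMost C d) {n} (φ : trunc A n ≅ trunc C n) where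
  open _≅_ φ
  open SubtreeIso A C proj₁ (trunc-parent A n) φ public
  private
    module BA = Branch A bw
    module BC = Branch C bv

  -- w n is mapped to a vertex at depth n of C whose ancestor at depth j is periodic, hence is v j
  branch-image : ∀ j → j + d ≤ n → to (w j , j) ≡ (v j , j)
  branch-image j j+d≤n = cong₂ _,_ state-image (to-depth (BA.branch∈tree j , j≤n))
    where
      j≤n = m+n≤o⇒m≤o j j+d≤n
      wn∈ = BA.branch∈tree n , ≤-refl
      z = proj₁ (to (w n , n))
      z∈ : iter (step C) n z ≡ Unroll.u C
      z∈ = subst (λ k → iter (step C) k z ≡ Unroll.u C) (to-depth wn∈) (proj₁ (to-mem wn∈))
      ancestor-periodic : Periodic (step C) (iter (step C) (n ∸ j) z)
      ancestor-periodic = depth-periodic C DC (m+n≤o⇒n≤o∸m j j+d≤n) (n , z∈)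
      state-image : proj₁ (to (w j , j)) ≡ v j
      state-image = begin
        proj₁ (to (w j , j))
          ≡⟨ cong (λ s → proj₁ (to (s , j))) (sym (BA.iter-branch-∸ j≤n)) ⟩
        proj₁ (to (iter (step A) (n ∸ j) (w n) , j))
          ≡⟨ to-iter (n ∸ j) (m∸n+n≡m j≤n) wn∈ ⟩
        iter (step C) (n ∸ j) z
          ≡⟨ BC.periodic-on-branch DC j ancestor-periodic (trans (iter-∸ (step C) z j≤n) z∈) ⟩
        v j
          ∎
        where open ≡-Reasoning

  to-below : ∀ j {s k} → j + d ≤ n → mem (trunc A n) (s , k) →
             BA.Below j (s , k) → BC.Below j (proj₁ (to (s , k)) , k)
  to-below j {s} {k} j+d≤n x∈ (j≤k , e) = j≤k , (begin
    iter (step C) (k ∸ j) (proj₁ (to (s , k)))   ≡⟨ to-iter (k ∸ j) (m∸n+n≡m j≤k) x∈ ⟨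
    proj₁ (to (iter (step A) (k ∸ j) s , j))     ≡⟨ cong (λ s′ → proj₁ (to (s′ , j))) e ⟩
    proj₁ (to (w j , j))                         ≡⟨ cong proj₁ (branch-image j j+d≤n) ⟩
    v j                                          ∎)
    where open ≡-Reasoning

  piece⊆trunc : ∀ j {s k} → suc j + d ≤ n → mem (piece A w j) (s , k) → mem (trunc A n) (s , k)
  piece⊆trunc j 1+j+d≤n pm =
    BA.piece⊆tree pm , ≤-trans (BA.piece-height DA pm) (≤-trans (n≤1+n _) 1+j+d≤n)

to-piece : ∀ A C {w v} (bw : IsBranch A w) (bv : IsBranch C v) {d}
  (DA : DepthAtMost A d) (DC : DepthAtMost C d) {n} (φ : trunc A n ≅ trunc C n) →
  ∀ j {s k} → suc j + d ≤ n → mem (piece A w j) (s , k) → mem (piece C v j) (_≅_.to φ (s , k))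
to-piece A C {w} {v} bw bv DA DC {n} φ j {s} {k} 1+j+d≤n pm@(_ , _ , ¬below) =
  subst (mem (piece C v j)) (sym to≡)
    (proj₁ below , proj₂ below , λ below′ → ¬below (back below′))
  where
    open _≅_ φ
    module BA = Branch A bw
    module BC = Branch C bv
    module Forth = Restrict A C bw bv DA DC φ
    module Back  = Restrict C A bv bw DC DA (≅-sym (refl , z≤n) φ)
    x∈ = Forth.piece⊆trunc j 1+j+d≤n pm
    s′ = proj₁ (to (s , k))
    to≡ : to (s , k) ≡ (s′ , k)
    to≡ = cong (s′ ,_) (Forth.to-depth x∈)
    y∈ : mem (trunc C n) (s′ , k)
    y∈ = subst (mem (trunc C n)) to≡ (to-mem x∈)
    from≡ : from (s′ , k) ≡ (s , k)
    from≡ = trans (cong from (sym to≡)) (from-to x∈)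
    below : BC.Below j (s′ , k)
    below = Forth.to-below j (≤-trans (n≤1+n _) 1+j+d≤n) x∈ (BA.piece⊆below pm)
    back : BC.Below (suc j) (s′ , k) → BA.Below (suc j) (s , k)
    back below′ = subst (BA.Below (suc j)) (cong (λ x → proj₁ x , k) from≡)
                    (Back.to-below (suc j) 1+j+d≤n y∈ below′)

trunc⇒piece-≅ : ∀ A C {w v} (bw : IsBranch A w) (bv : IsBranch C v) {d}
  (DA : DepthAtMost A d) (DC : DepthAtMost C d) {n} → trunc A n ≅ trunc C n →
  ∀ j → suc j + d ≤ n → piece A w j ≅ piece C v j
trunc⇒piece-≅ A C bw bv DA DC φ j le = record
  { to = to ; from = from
  ; to-mem = to-piece A C bw bv DA DC φ j le
  ; from-mem = to-piece C A bv bw DC DA φ⁻¹ j le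
  ; from-to = λ x∈ → from-to (Forth.piece⊆trunc j le x∈)
  ; to-from = λ y∈ → to-from (Back.piece⊆trunc j le y∈)
  ; to-root = Forth.branch-image j (≤-trans (n≤1+n _) le)
  ; to-arc = λ x∈ y∈ → to-arc (Forth.piece⊆trunc j le x∈) (Forth.piece⊆trunc j le y∈)
  ; from-arc = λ x∈ y∈ → from-arc (Back.piece⊆trunc j le x∈) (Back.piece⊆trunc j le y∈) }
  where
    open _≅_ φ
    φ⁻¹ = ≅-sym (refl , z≤n) φ
    module Forth = Restrict A C bw bv DA DC φ
    module Back  = Restrict C A bv bw DC DA φ⁻¹

module _ {X Y : ℕ → RTree}
  (X-root : ∀ i → mem (X i) (root (X i))) (Y-root : ∀ i → mem (Y i) (root (Y i)))
  {a b} .{{_ : NonZero a}} .{{_ : NonZero b}}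
  (X-period : ∀ i → X (i + a) ≅ X i) (Y-period : ∀ i → Y (i + b) ≅ Y i) where

  periodic-agree : (∀ i → i < a + b → X i ≅ Y i) → ∀ i → X i ≅ Y i
  periodic-agree agree = <-rec (λ i → X i ≅ Y i) extend
    where
      beyond : ∀ k → (∀ {j} → j < k + (a + b) → X j ≅ Y j) →
               X (k + (a + b)) ≅ Y (k + (a + b))
      beyond k rec =
        X-period′ (k + b) (trans (+-assoc k b a) (cong (k +_) (+-comm b a)))
          ⨾ rec (+-monoʳ-< k (m<n+m b a>0))
          ⨾ Y-period k
          ⨾ ≅-sym (X-root k) (rec (m<m+n k (<-≤-trans a>0 (m≤m+n a b))))
          ⨾ ≅-sym (X-root (k + a)) (X-period k)
          ⨾ rec (+-monoʳ-< k (m<m+n a b>0))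
          ⨾ ≅-sym (Y-root (k + (a + b))) (Y-period′ (k + a) (+-assoc k a b))
        where
          a>0 = >-nonZero⁻¹ a
          b>0 = >-nonZero⁻¹ b
          X-period′ : ∀ i {j} → i + a ≡ j → X j ≅ X i
          X-period′ i refl = X-period i
          Y-period′ : ∀ i {j} → i + b ≡ j → Y j ≅ Y i
          Y-period′ i refl = Y-period i

      extend : ∀ i → (∀ {j} → j < i → X j ≅ Y j) → X i ≅ Y i
      extend i rec with i <? a + b
      ... | yes i<a+b = agree i i<a+b
      ... | no i≮a+b with i ∸ (a + b) | m∸n+n≡m (≮⇒≥ i≮a+b)
      ...   | k | refl = beyond k rec

pattern-period : ∀ {X : ℕ → RTree} → (∀ i → mem (X i) (root (X i))) → ∀ p .{{_ : NonZero p}} →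
                 (∀ i → X i ≅ X (i % p)) → ∀ i → X (i + p) ≅ X i
pattern-period {X} X-root p repeats i =
  subst (λ j → X (i + p) ≅ X j) ([m+n]%n≡m%n i p) (repeats (i + p)) ⨾ ≅-sym (X-root i) (repeats i)

lemma4 : (A C : Unroll) (a b da db n : ℕ)
    → HasPattern A a → HasPattern C b
    → IsDepth A da → IsDepth C db
    → 2 * (a ⊔ b) + (da ⊔ db) ≤ n
    → (¬ (unrollTree A ≅ unrollTree C) → ¬ (trunc A n ≅ trunc C n))
      × (¬ (trunc A n ≅ trunc C n) → ¬ (unrollTree A ≅ unrollTree C))
lemma4 A C a b da db n (_ , refl , w , bw , A-repeats) (_ , refl , v , bv , C-repeats) DA DC n-large =
  (λ ¬tree≅ φ → ¬tree≅ (trunc⇒tree-≅ φ)) , (λ ¬trunc≅ ψ → ¬trunc≅ (trunc-≅ A C n ψ))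
  where
    module BA = Branch A bw
    module BC = Branch C bv
    d = da ⊔ db
    DA′ = IsDepth⇒DepthAtMost A DA (m≤m⊔n da db)
    DC′ = IsDepth⇒DepthAtMost C DC (m≤n⊔m da db)
    a+b≤2[a⊔b] : a + b ≤ 2 * (a ⊔ b)
    a+b≤2[a⊔b] = +-mono-≤ (m≤m⊔n a b) (≤-trans (m≤n⊔m a b) (m≤m+n (a ⊔ b) 0))
    bound : ∀ {j} → j < a + b → suc j + d ≤ n
    bound j<a+b = ≤-trans (+-monoˡ-≤ d (≤-trans j<a+b a+b≤2[a⊔b])) n-large
    trunc⇒tree-≅ : trunc A n ≅ trunc C n → unrollTree A ≅ unrollTree C
    trunc⇒tree-≅ φ = glue A C bw bv (periodic-agree BA.root∈piece BC.root∈piece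
      (pattern-period BA.root∈piece a A-repeats) (pattern-period BC.root∈piece b C-repeats)
      (λ j j<a+b → trunc⇒piece-≅ A C bw bv DA′ DC′ φ j (bound j<a+b)))
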